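{- For all $n,k\ge1$, the last word of the sequence $D(n,k)$ is $(k-1)0^{n-1}$.
   Context: Words are finite sequences of symbols from $[k]=\{0,1,\dots,k-1\}$; $\sigma^t$ denotes $t$ repetitions of $\sigma$. A rotation of $xy$ is $yx$. For words of equal length, $w_1\le_{\mathrm{colex}} w_2$ means the reversal of $w_1$ is lexicographically $\le$ the reversal of $w_2$. Fix $n\ge1$. A key-word is a length-$n$ word that is colex-maximal among its rotations. Let $c(n,k)$ be the number of key-words in $[k]^n$, listed in increasing colex order $\mathrm{key}_0<\cdots<\mathrm{key}_{c(n,k)-1}$ ($\mathrm{key}_0=0^n$). Cycles: $C_0=(0^n)$. For $m\ge1$ write $\mathrm{key}_m=0^l(\sigma+1)w$ ($l\ge0$); $C_m$ is the sequence of all distinct rotations of $\mathrm{key}_m$, starting with $\mathrm{first}(C_m)=w0^l(\sigma+1)$, in which each word $\tau w'$ is followed by $w'\tau$, ending with $\mathrm{last}(C_m)=(\sigma+1)w0^l$. Construction: $D_0=(0^n)$; writing $\mathrm{key}_{m+1}=0^l(\sigma+1)w$, $D_{m+1}$ is obtained from $D_m$ by inserting the sequence $C_{m+1}$ immediately after the word $\sigma w0^l$ of $D_m$. Set $D(n,k)=D_{c(n,k)-1}$. -}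

module Defs where

open import Data.Nat using (ℕ; zero; suc; _∸_; _<ᵇ_; _≡ᵇ_)
open import Data.Bool using (Bool; true; false; _∧_; _∨_; if_then_else_)
open import Data.List using (List; []; _∷_; _++_; map; concatMap; upTo; replicate;
  reverse; drop; take; length; filterᵇ; deduplicate; iterate; foldl)
open import Relation.Nullary using (yes; no)
open import Data.List.Properties using (≡-dec)
open import Data.Product using (_×_; _,_)
import Data.Nat as N

Word : Set
Word = List ℕ

wordsLex : ℕ → ℕ → List Word
wordsLex zero    k = [] ∷ []
wordsLex (suc n) k = concatMap (λ a → map (a ∷_) (wordsLex n k)) (upTo k)

lexLeq : Word → Word → Bool
lexLeq []       _        = true
lexLeq (_ ∷ _)  []       = false
lexLeq (a ∷ u)  (b ∷ v)  = (a <ᵇ b) ∨ ((a ≡ᵇ b) ∧ lexLeq u v)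

colexLeq : Word → Word → Bool
colexLeq u v = lexLeq (reverse u) (reverse v)

rot : ℕ → Word → Word
rot i w = drop i w ++ take i w

rotations : Word → List Word
rotations w = map (λ i → rot i w) (upTo (length w))

allB : (Word → Bool) → List Word → Bool
allB p []       = true
allB p (x ∷ xs) = p x ∧ allB p xs

isKey : Word → Bool
isKey w = allB (λ r → colexLeq r w) (rotations w)

wordsColex : ℕ → ℕ → List Word
wordsColex n k = map reverse (wordsLex n k)

keys : ℕ → ℕ → List Word
keys n k = filterᵇ isKey (wordsColex n k)

-- decompose a word as 0^l s w with s ≠ 0 (s = σ+1); returns (l , s , w)
splitKey : Word → ℕ × ℕ × Word
splitKey []            = 0 , 0 , []
splitKey (zero ∷ u)    with splitKey u
... | l , s , w = suc l , s , w
splitKey (suc a ∷ u)   = 0 , suc a , u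

rotL : Word → Word
rotL []      = []
rotL (t ∷ u) = u ++ (t ∷ [])

numRot : Word → ℕ
numRot w = length (deduplicate (≡-dec N._≟_) (rotations w))

cycleOf : Word → List Word
cycleOf key with splitKey key
... | l , s , w = iterate rotL (w ++ replicate l 0 ++ (s ∷ [])) (numRot key)

anchorOf : Word → Word
anchorOf key with splitKey key
... | l , s , w = (s ∸ 1) ∷ (w ++ replicate l 0)

-- insert ys immediately after the first occurrence of x
-- (convention: if x does not occur, the list is unchanged)
insertAfter : Word → List Word → List Word → List Word
insertAfter x ys []       = []
insertAfter x ys (z ∷ zs) with ≡-dec N._≟_ z x
... | yes _ = z ∷ ys ++ zs
... | no  _ = z ∷ insertAfter x ys zs

step : List Word → Word → List Word
step D key = insertAfter (anchorOf key) (cycleOf key) D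

-- D(n,k) = D_{c(n,k)-1}, starting from D_0 = (0^n), processing key_1, key_2, …
D : ℕ → ℕ → List Word
D n k = foldl step (replicate n 0 ∷ []) (drop 1 (keys n k))

-- Colex order lists the keys block by block according to their last letter
-- a = 0, 1, …, k−1, and the first key of block a is 0ⁿ⁻¹a. Every other key of
-- the block has at least two nonzero letters: a word with a nonzero letter that
-- ends in 0 is never a key, because rotating that letter to the end makes it
-- colex-larger. By induction over the blocks, after block j the list ends with
-- j0ⁿ⁻¹ and no earlier word is c0ⁿ⁻¹ with c ≥ j. The key 0ⁿ⁻¹(j+1) has anchor
-- j0ⁿ⁻¹, so its cycle, whose last word is (j+1)0ⁿ⁻¹, is appended at the end.
-- Any other key has an anchor with a nonzero letter after the first one and a
-- cycle of words with two nonzero letters; none of these is of the form c0ⁿ⁻¹,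
-- so the insertion happens before the last word.
module Submission where

open import Defs
open import Data.Nat using (ℕ; zero; suc; _≤_; _<_; _∸_; _+_; z≤n; s≤s)
open import Data.Nat.Properties
  using (+-suc; +-identityʳ; +-comm; +-monoˡ-≤; ≤-refl; ≤-trans; ≤-pred; n≤1+n; 1+n≰n; <-irrefl;
         m<n⇒m<1+n; m+[n∸m]≡n)
import Data.Nat as ℕ
open import Data.Bool using (T)
open import Data.Bool.Properties using (T-∧)
open import Data.List
  using (List; []; _∷_; [_]; _++_; _∷ʳ_; map; concatMap; upTo; applyUpTo; replicate; reverse;
         drop; take; length; filter; filterᵇ; deduplicate; iterate; foldl; last)
open import Data.List.Properties
  using (∷-injectiveˡ; ∷-injectiveʳ; ++-assoc; ++-identityʳ; map-cong-local; map-concatMap;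
         concatMap-cong; concatMap-++; applyUpTo-∷ʳ; foldl-++; length-replicate; length-map;
         length-upTo; unfold-reverse; reverse-++; filter-++; filter-all; filter-accept; ≡-dec)
open import Data.List.Relation.Unary.All as All using (All; []; _∷_)
open import Data.List.Relation.Unary.All.Properties
  using (++⁺; map⁺; concat⁺; applyUpTo⁺₁; applyUpTo⁺₂; all-filter; filter⁺)
import Data.List.Relation.Unary.AllPairs as AllPairs
open import Data.List.Relation.Unary.Any using (here; there)
open import Data.List.Relation.Unary.Unique.Propositional using (Unique)
import Data.List.Relation.Unary.Unique.Propositional.Properties as Unique
open import Data.List.Membership.Propositional using (_∈_)
open import Data.List.Membership.Propositional.Properties using (∈-map⁺; ∈-upTo⁺)
open import Data.Maybe using (just)
open import Data.Product using (∃-syntax; _×_; _,_; proj₁; proj₂)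
open import Data.Empty using (⊥-elim)
open import Function using (_∘_; id)
open import Function.Bundles using (Equivalence)
open import Relation.Nullary using (¬_; yes; no; ¬?)
open import Relation.Nullary.Decidable using (T?)
open import Relation.Unary using (Pred; Decidable)
open import Relation.Binary.Definitions using (DecidableEquality)
open import Level using (0ℓ)
open import Relation.Binary.PropositionalEquality
  using (_≡_; _≢_; refl; sym; trans; cong; cong₂; subst; module ≡-Reasoning)

open ≡-Reasoning

last-∷ʳ : ∀ {A : Set} (xs : List A) x → last (xs ∷ʳ x) ≡ just x
last-∷ʳ []           x = refl
last-∷ʳ (_ ∷ [])     x = refl
last-∷ʳ (_ ∷ y ∷ xs) x = last-∷ʳ (y ∷ xs) x

replicate-∷ʳ : ∀ {A : Set} q (x : A) → replicate q x ∷ʳ x ≡ x ∷ replicate q x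
replicate-∷ʳ zero    x = refl
replicate-∷ʳ (suc q) x = cong (x ∷_) (replicate-∷ʳ q x)

reverse-replicate : ∀ {A : Set} p (x : A) → reverse (replicate p x) ≡ replicate p x
reverse-replicate zero    x = refl
reverse-replicate (suc p) x = begin
  reverse (x ∷ replicate p x)  ≡⟨ unfold-reverse x (replicate p x) ⟩
  reverse (replicate p x) ∷ʳ x ≡⟨ cong (_∷ʳ x) (reverse-replicate p x) ⟩
  replicate p x ∷ʳ x           ≡⟨ replicate-∷ʳ p x ⟩
  x ∷ replicate p x            ∎

drop-replicate-++ : ∀ {A : Set} {x : A} i m t → i ≤ m →
                    drop i (replicate m x ++ t) ≡ replicate (m ∸ i) x ++ t
drop-replicate-++ zero    m       t _         = refl
drop-replicate-++ (suc i) (suc m) t (s≤s i≤m) = drop-replicate-++ i m t i≤m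

take-replicate-++ : ∀ {A : Set} {x : A} i m t → i ≤ m → take i (replicate m x ++ t) ≡ replicate i x
take-replicate-++ zero    m       t _         = refl
take-replicate-++ (suc i) (suc m) t (s≤s i≤m) = cong (_ ∷_) (take-replicate-++ i m t i≤m)

filter-concatMap : ∀ {A B : Set} {P : Pred B 0ℓ} (P? : Decidable P) (f : A → List B) xs →
                   filter P? (concatMap f xs) ≡ concatMap (filter P? ∘ f) xs
filter-concatMap P? f []       = refl
filter-concatMap P? f (x ∷ xs) =
  trans (filter-++ P? (f x) (concatMap f xs)) (cong (filter P? (f x) ++_) (filter-concatMap P? f xs))

deduplicate-unique : ∀ {A : Set} (_≟_ : DecidableEquality A) {xs} → Unique xs → deduplicate _≟_ xs ≡ xs
deduplicate-unique _≟_ {[]}     _                    = refl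
deduplicate-unique _≟_ {x ∷ xs} (x∉xs AllPairs.∷ xs!) rewrite deduplicate-unique _≟_ xs! =
  cong (x ∷_) (filter-all (¬? ∘ (x ≟_)) x∉xs)

weight : Word → ℕ
weight []          = 0
weight (zero ∷ u)  = weight u
weight (suc _ ∷ u) = suc (weight u)

weight-++ : ∀ u v → weight (u ++ v) ≡ weight u + weight v
weight-++ []          v = refl
weight-++ (zero ∷ u)  v = weight-++ u v
weight-++ (suc _ ∷ u) v = cong suc (weight-++ u v)

weight-replicate-0 : ∀ p → weight (replicate p 0) ≡ 0
weight-replicate-0 zero    = refl
weight-replicate-0 (suc p) = weight-replicate-0 p

weight-∷ʳ : ∀ u a → weight (u ∷ʳ a) ≡ weight (a ∷ u)
weight-∷ʳ u a = begin
  weight (u ∷ʳ a)           ≡⟨ weight-++ u [ a ] ⟩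
  weight u + weight [ a ]   ≡⟨ +-comm (weight u) _ ⟩
  weight [ a ] + weight u   ≡⟨ weight-++ [ a ] u ⟨
  weight (a ∷ u)            ∎

weight-rotL : ∀ u → weight (rotL u) ≡ weight u
weight-rotL []      = refl
weight-rotL (a ∷ u) = weight-∷ʳ u a

weight-reverse : ∀ u → weight (reverse u) ≡ weight u
weight-reverse []      = refl
weight-reverse (a ∷ u) = begin
  weight (reverse (a ∷ u))   ≡⟨ cong weight (unfold-reverse a u) ⟩
  weight (reverse u ∷ʳ a)    ≡⟨ weight-∷ʳ (reverse u) a ⟩
  weight (a ∷ reverse u)     ≡⟨ weight-++ [ a ] (reverse u) ⟩
  weight [ a ] + weight (reverse u) ≡⟨ cong (weight [ a ] +_) (weight-reverse u) ⟩
  weight [ a ] + weight u    ≡⟨ weight-++ [ a ] u ⟨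
  weight (a ∷ u)             ∎

weight-iterate-rotL : ∀ u n → All (λ r → weight r ≡ weight u) (iterate rotL u n)
weight-iterate-rotL u zero    = []
weight-iterate-rotL u (suc n) =
  refl ∷ All.map (λ e → trans e (weight-rotL u)) (weight-iterate-rotL (rotL u) n)

weight-leading : ∀ l s w → weight (replicate l 0 ++ suc s ∷ w) ≡ suc (weight w)
weight-leading zero    s w = refl
weight-leading (suc l) s w = weight-leading l s w

leading-nonzero : ∀ v → 1 ≤ weight v → ∃[ l ] ∃[ s ] ∃[ w ] v ≡ replicate l 0 ++ suc s ∷ w
leading-nonzero (zero ∷ v)  v≥1 with leading-nonzero v v≥1
... | l , s , w , refl = suc l , s , w , refl
leading-nonzero (suc s ∷ w) _   = 0 , s , w , refl

splitKey-leading : ∀ l s w → splitKey (replicate l 0 ++ suc s ∷ w) ≡ (l , suc s , w)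
splitKey-leading zero    s w = refl
splitKey-leading (suc l) s w rewrite splitKey-leading l s w = refl

anchorOf-leading : ∀ l s w → anchorOf (replicate l 0 ++ suc s ∷ w) ≡ s ∷ w ++ replicate l 0
anchorOf-leading l s w rewrite splitKey-leading l s w = refl

cycleOf-leading : ∀ l s w → let key = replicate l 0 ++ suc s ∷ w in
                  cycleOf key ≡ iterate rotL (w ++ replicate l 0 ++ [ suc s ]) (numRot key)
cycleOf-leading l s w rewrite splitKey-leading l s w = refl

-- A key with a nonzero letter ends with a nonzero letter

allB⁺ : ∀ p xs → All (T ∘ p) xs → T (allB p xs)
allB⁺ p []       []         = _
allB⁺ p (x ∷ xs) (px ∷ pxs) = Equivalence.from T-∧ (px , allB⁺ p xs pxs)

allB⁻ : ∀ p xs {x} → T (allB p xs) → x ∈ xs → T (p x)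
allB⁻ p (y ∷ xs) all (here refl) = proj₁ (Equivalence.to T-∧ all)
allB⁻ p (y ∷ xs) all (there x∈)  = allB⁻ p xs (proj₂ (Equivalence.to T-∧ all)) x∈

rot∈rotations : ∀ w {i} → i < length w → rot i w ∈ rotations w
rot∈rotations w i<∣w∣ = ∈-map⁺ (λ i → rot i w) (∈-upTo⁺ i<∣w∣)

colexLeq-∷ʳ : ∀ u v a b → colexLeq (u ∷ʳ a) (v ∷ʳ b) ≡ lexLeq (a ∷ reverse u) (b ∷ reverse v)
colexLeq-∷ʳ u v a b = cong₂ lexLeq (reverse-++ u [ a ]) (reverse-++ v [ b ])

drop-past : ∀ (p : Word) x t u → drop (suc (length p)) ((p ++ x ∷ t) ++ u) ≡ t ++ u
drop-past []      x t u = refl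
drop-past (_ ∷ p) x t u = drop-past p x t u

take-past : ∀ (p : Word) x t u → take (suc (length p)) ((p ++ x ∷ t) ++ u) ≡ p ∷ʳ x
take-past []      x t u = refl
take-past (y ∷ p) x t u = cong (y ∷_) (take-past p x t u)

past<length : ∀ (p : Word) x t y → suc (length p) < length ((p ++ x ∷ t) ∷ʳ y)
past<length []      x []      y = s≤s (s≤s z≤n)
past<length []      x (_ ∷ t) y = s≤s (s≤s z≤n)
past<length (_ ∷ p) x t       y = s≤s (past<length p x t y)

¬isKey-∷ʳ0 : ∀ p s t → ¬ T (isKey ((p ++ suc s ∷ t) ∷ʳ 0))
¬isKey-∷ʳ0 p s t key = subst T (colexLeq-∷ʳ ((t ∷ʳ 0) ++ p) (p ++ suc s ∷ t) (suc s) 0)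
  (subst (λ r → T (colexLeq r v)) rot≡ (allB⁻ _ _ key (rot∈rotations v (past<length p (suc s) t 0))))
  where
  v = (p ++ suc s ∷ t) ∷ʳ 0
  rot≡ : rot (suc (length p)) v ≡ ((t ∷ʳ 0) ++ p) ∷ʳ suc s
  rot≡ = trans (cong₂ _++_ (drop-past p (suc s) t [ 0 ]) (take-past p (suc s) t [ 0 ]))
               (sym (++-assoc (t ∷ʳ 0) p [ suc s ]))

key-weight≥2 : ∀ u a → 1 ≤ weight u → T (isKey (u ∷ʳ a)) → 2 ≤ weight (u ∷ʳ a)
key-weight≥2 u zero u≥1 key with leading-nonzero u u≥1
... | l , s , w , refl = ⊥-elim (¬isKey-∷ʳ0 (replicate l 0) s w key)
key-weight≥2 u (suc a) u≥1 _ = subst (2 ≤_) (sym (weight-∷ʳ u (suc a))) (s≤s u≥1)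

padded : ℕ → ℕ → ℕ → Word
padded p a q = replicate p 0 ++ a ∷ replicate q 0

padded-∷ʳ0 : ∀ p a q → padded p a q ∷ʳ 0 ≡ padded p a (suc q)
padded-∷ʳ0 p a q = trans (++-assoc (replicate p 0) (a ∷ replicate q 0) [ 0 ])
                         (cong (λ z → replicate p 0 ++ a ∷ z) (replicate-∷ʳ q 0))

reverse-padded : ∀ p a q → reverse (padded p a q) ≡ padded q a p
reverse-padded p a q = begin
  reverse (replicate p 0 ++ a ∷ replicate q 0)
    ≡⟨ reverse-++ (replicate p 0) (a ∷ replicate q 0) ⟩
  reverse (a ∷ replicate q 0) ++ reverse (replicate p 0)
    ≡⟨ cong₂ _++_ (trans (unfold-reverse a (replicate q 0)) (cong (_∷ʳ a) (reverse-replicate q 0)))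
                  (reverse-replicate p 0) ⟩
  (replicate q 0 ∷ʳ a) ++ replicate p 0
    ≡⟨ ++-assoc (replicate q 0) [ a ] (replicate p 0) ⟩
  padded q a p ∎

length-padded-end : ∀ m a → length (padded m a 0) ≡ suc m
length-padded-end zero    a = refl
length-padded-end (suc m) a = cong suc (length-padded-end m a)

padded-injective : ∀ b p q p′ q′ → padded p (suc b) q ≡ padded p′ (suc b) q′ → q ≡ q′
padded-injective b zero    q zero     q′ e =
  trans (sym (length-replicate q)) (trans (cong length (∷-injectiveʳ e)) (length-replicate q′))
padded-injective b zero    q (suc p′) q′ ()
padded-injective b (suc p) q zero     q′ ()
padded-injective b (suc p) q (suc p′) q′ e = padded-injective b p q p′ q′ (∷-injectiveʳ e)

rot-padded : ∀ m a i → i ≤ m → rot i (padded m a 0) ≡ padded (m ∸ i) a i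
rot-padded m a i i≤m =
  trans (cong₂ _++_ (drop-replicate-++ i m [ a ] i≤m) (take-replicate-++ i m [ a ] i≤m))
        (++-assoc (replicate (m ∸ i) 0) [ a ] (replicate i 0))

rotations-padded : ∀ m a → rotations (padded m a 0) ≡ map (λ i → padded (m ∸ i) a i) (upTo (suc m))
rotations-padded m a =
  trans (cong (λ n → map (λ i → rot i (padded m a 0)) (upTo n)) (length-padded-end m a))
        (map-cong-local (applyUpTo⁺₁ id (suc m) (λ i<1+m → rot-padded m a _ (≤-pred i<1+m))))

lexLeq-∷-same : ∀ a u v → lexLeq (a ∷ u) (a ∷ v) ≡ lexLeq u v
lexLeq-∷-same zero    u v = refl
lexLeq-∷-same (suc a) u v = lexLeq-∷-same a u v

lexLeq-refl : ∀ u → T (lexLeq u u)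
lexLeq-refl []      = _
lexLeq-refl (a ∷ u) = subst T (sym (lexLeq-∷-same a u u)) (lexLeq-refl u)

lexLeq-padded : ∀ q p a → T (lexLeq (padded q a p) (padded 0 a (q + p)))
lexLeq-padded zero    p a       = lexLeq-refl (padded 0 a p)
lexLeq-padded (suc q) p zero    = lexLeq-padded q p zero
lexLeq-padded (suc q) p (suc a) = _

colexLeq-rot-padded : ∀ m a i → i ≤ m → T (colexLeq (padded (m ∸ i) a i) (padded m a 0))
colexLeq-rot-padded m a i i≤m =
  subst T (sym (cong₂ lexLeq (reverse-padded (m ∸ i) a i) (reverse-padded m a 0)))
    (subst (λ r → T (lexLeq (padded i a (m ∸ i)) (padded 0 a r))) (m+[n∸m]≡n i≤m)
      (lexLeq-padded i (m ∸ i) a))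

isKey-padded : ∀ m a → T (isKey (padded m a 0))
isKey-padded m a = allB⁺ _ _
  (subst (All (λ r → T (colexLeq r (padded m a 0)))) (sym (rotations-padded m a))
    (map⁺ (applyUpTo⁺₁ id (suc m) (λ i<1+m → colexLeq-rot-padded m a _ (≤-pred i<1+m)))))

numRot-padded : ∀ m b → numRot (padded m (suc b) 0) ≡ suc m
numRot-padded m b = begin
  length (deduplicate _≟ʷ_ (rotations (padded m (suc b) 0)))
    ≡⟨ cong (length ∘ deduplicate _≟ʷ_) (rotations-padded m (suc b)) ⟩
  length (deduplicate _≟ʷ_ (map rotation (upTo (suc m))))
    ≡⟨ cong length (deduplicate-unique _≟ʷ_ (Unique.map⁺ rotation-injective (Unique.upTo⁺ (suc m)))) ⟩
  length (map rotation (upTo (suc m)))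
    ≡⟨ length-map rotation (upTo (suc m)) ⟩
  length (upTo (suc m))
    ≡⟨ length-upTo (suc m) ⟩
  suc m ∎
  where
  _≟ʷ_ = ≡-dec ℕ._≟_
  rotation : ℕ → Word
  rotation i = padded (m ∸ i) (suc b) i
  rotation-injective : ∀ {i j} → rotation i ≡ rotation j → i ≡ j
  rotation-injective {i} {j} = padded-injective b (m ∸ i) i (m ∸ j) j

iterate-rotL-padded : ∀ p q a → ∃[ Q ] iterate rotL (padded p a q) (suc p) ≡ Q ∷ʳ padded 0 a (p + q)
                                      × All (λ v → ∃[ t ] v ≡ 0 ∷ t) Q
iterate-rotL-padded zero    q a = [] , refl , []
iterate-rotL-padded (suc p) q a with iterate-rotL-padded p (suc q) a
... | Q , cycle≡ , zero-headed = padded (suc p) a q ∷ Q , cong (padded (suc p) a q ∷_) (begin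
      iterate rotL (padded p a q ∷ʳ 0) (suc p)
        ≡⟨ cong (λ v → iterate rotL v (suc p)) (padded-∷ʳ0 p a q) ⟩
      iterate rotL (padded p a (suc q)) (suc p)
        ≡⟨ cycle≡ ⟩
      Q ∷ʳ padded 0 a (p + suc q)
        ≡⟨ cong (λ r → Q ∷ʳ padded 0 a r) (+-suc p q) ⟩
      Q ∷ʳ padded 0 a (suc p + q) ∎) , (_ , refl) ∷ zero-headed

insertAfter-first : ∀ x ys P R → All (_≢ x) P → insertAfter x ys (P ++ x ∷ R) ≡ P ++ x ∷ ys ++ R
insertAfter-first x ys []      R []          with ≡-dec ℕ._≟_ x x
... | yes _   = refl
... | no  x≢x = ⊥-elim (x≢x refl)
insertAfter-first x ys (z ∷ P) R (z≢x ∷ P≢x) with ≡-dec ℕ._≟_ z x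
... | yes z≡x = ⊥-elim (z≢x z≡x)
... | no  _   = cong (z ∷_) (insertAfter-first x ys P R P≢x)

insertAfter-∷ʳ : ∀ x ys P {L} → L ≢ x → insertAfter x ys (P ∷ʳ L) ≡ insertAfter x ys P ∷ʳ L
insertAfter-∷ʳ x ys []      {L} L≢x with ≡-dec ℕ._≟_ L x
... | yes L≡x = ⊥-elim (L≢x L≡x)
... | no  _   = refl
insertAfter-∷ʳ x ys (z ∷ P) {L} L≢x with ≡-dec ℕ._≟_ z x
... | yes _ = cong (z ∷_) (sym (++-assoc ys P [ L ]))
... | no  _ = cong (z ∷_) (insertAfter-∷ʳ x ys P L≢x)

All-insertAfter : ∀ {A : Word → Set} x ys xs → All A xs → All A ys → All A (insertAfter x ys xs)
All-insertAfter x ys []       []         _   = []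
All-insertAfter x ys (z ∷ zs) (az ∷ azs) ays with ≡-dec ℕ._≟_ z x
... | yes _ = az ∷ ++⁺ ays azs
... | no  _ = az ∷ All-insertAfter x ys zs azs ays

-- The invariant of the construction, for words of length m + 1

module Pivots (m : ℕ) where

  pivot : ℕ → Word
  pivot c = padded 0 c m

  PivotsBelow : ℕ → Word → Set
  PivotsBelow j v = ∀ c → v ≡ pivot c → c < j

  record EndsWithPivot (j : ℕ) (D : List Word) : Set where
    constructor ending
    field
      prefix      : List Word
      D≡          : D ≡ prefix ∷ʳ pivot j
      prefixBelow : All (PivotsBelow j) prefix

  weight-pivot : ∀ c → weight (pivot c) ≤ 1
  weight-pivot zero    = subst (_≤ 1) (sym (weight-replicate-0 m)) z≤n
  weight-pivot (suc c) = s≤s (subst (_≤ 0) (sym (weight-replicate-0 m)) z≤n)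

  heavy⇒PivotsBelow : ∀ {j v} → 2 ≤ weight v → PivotsBelow j v
  heavy⇒PivotsBelow v≥2 c refl with ≤-trans v≥2 (weight-pivot c)
  ... | s≤s ()

  step-simple : ∀ {j D} → EndsWithPivot j D → EndsWithPivot (suc j) (step D (padded m (suc j) 0))
  step-simple {j} (ending P refl below) with iterate-rotL-padded m 0 (suc j)
  ... | Q , cycle≡ , zero-headed =
    ending (P ++ pivot j ∷ Q) D≡ (++⁺ (All.map weaken below) (pivot-j ∷ All.map zero-head⇒ zero-headed))
    where
    key = padded m (suc j) 0
    D≡ : step (P ∷ʳ pivot j) key ≡ (P ++ pivot j ∷ Q) ∷ʳ pivot (suc j)
    D≡ = begin
      insertAfter (anchorOf key) (cycleOf key) (P ∷ʳ pivot j)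
        ≡⟨ cong₂ (λ x ys → insertAfter x ys (P ∷ʳ pivot j)) (anchorOf-leading m j [])
                 (trans (cycleOf-leading m j []) (cong (iterate rotL key) (numRot-padded m j))) ⟩
      insertAfter (pivot j) (iterate rotL key (suc m)) (P ∷ʳ pivot j)
        ≡⟨ insertAfter-first (pivot j) _ P [] (All.map (λ b e → <-irrefl refl (b j e)) below) ⟩
      P ++ pivot j ∷ iterate rotL key (suc m) ++ []
        ≡⟨ cong (λ c → P ++ pivot j ∷ c) (trans (++-identityʳ _) cycle≡) ⟩
      P ++ pivot j ∷ Q ∷ʳ padded 0 (suc j) (m + 0)
        ≡⟨ cong (λ r → P ++ pivot j ∷ Q ∷ʳ padded 0 (suc j) r) (+-identityʳ m) ⟩
      P ++ pivot j ∷ Q ∷ʳ pivot (suc j)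
        ≡⟨ ++-assoc P (pivot j ∷ Q) _ ⟨
      (P ++ pivot j ∷ Q) ∷ʳ pivot (suc j) ∎
    weaken : ∀ {v} → PivotsBelow j v → PivotsBelow (suc j) v
    weaken b c e = m<n⇒m<1+n (b c e)
    pivot-j : PivotsBelow (suc j) (pivot j)
    pivot-j c e = s≤s (subst (_≤ j) (∷-injectiveˡ e) ≤-refl)
    zero-head⇒ : ∀ {v} → ∃[ t ] v ≡ 0 ∷ t → PivotsBelow (suc j) v
    zero-head⇒ (_ , refl) _ refl = s≤s z≤n

  step-heavy : ∀ {j D} key → 2 ≤ weight key → EndsWithPivot j D → EndsWithPivot j (step D key)
  step-heavy {j} key key≥2 (ending P refl below) with leading-nonzero key (≤-trans (n≤1+n 1) key≥2)
  ... | l , s , w , refl =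
    ending (insertAfter (anchorOf key) (cycleOf key) P)
           (insertAfter-∷ʳ (anchorOf key) (cycleOf key) P pivot≢anchor)
           (All-insertAfter (anchorOf key) (cycleOf key) P below cycle-below)
    where
    w≥1 : 1 ≤ weight w
    w≥1 = ≤-pred (subst (2 ≤_) (weight-leading l s w) key≥2)
    weight-tail : pivot j ≡ anchorOf key → weight w ≡ 0
    weight-tail e = begin
      weight w                          ≡⟨ +-identityʳ (weight w) ⟨
      weight w + 0                      ≡⟨ cong (weight w +_) (weight-replicate-0 l) ⟨
      weight w + weight (replicate l 0) ≡⟨ weight-++ w (replicate l 0) ⟨
      weight (w ++ replicate l 0)       ≡⟨ cong weight (∷-injectiveʳ (trans e (anchorOf-leading l s w))) ⟨
      weight (replicate m 0)            ≡⟨ weight-replicate-0 m ⟩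
      0                                 ∎
    pivot≢anchor : pivot j ≢ anchorOf key
    pivot≢anchor e = 1+n≰n (subst (1 ≤_) (weight-tail e) w≥1)
    start = w ++ replicate l 0 ++ [ suc s ]
    start≥2 : 2 ≤ weight start
    start≥2 = subst (2 ≤_) (sym (trans (weight-++ w _) (cong (weight w +_) (weight-leading l s []))))
                    (+-monoˡ-≤ 1 w≥1)
    cycle-below : All (PivotsBelow j) (cycleOf key)
    cycle-below = subst (All (PivotsBelow j)) (sym (cycleOf-leading l s w))
      (All.map (λ e → heavy⇒PivotsBelow (subst (2 ≤_) (sym e) start≥2)) (weight-iterate-rotL start _))

  foldl-heavy : ∀ {j D} ks → All (λ key → 2 ≤ weight key) ks →
                EndsWithPivot j D → EndsWithPivot j (foldl step D ks)
  foldl-heavy []         []              ends = ends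
  foldl-heavy (key ∷ ks) (key≥2 ∷ ks≥2) ends = foldl-heavy ks ks≥2 (step-heavy key key≥2 ends)

-- The keys, block by block

wordsLex-zeros-first : ∀ m k → ∃[ R ] wordsLex m (suc k) ≡ replicate m 0 ∷ R
                                   × All (λ u → 1 ≤ weight u) R
wordsLex-zeros-first zero    k = [] , refl , []
wordsLex-zeros-first (suc m) k with wordsLex-zeros-first m k
... | R , lex≡ , R≥1 =
  map (0 ∷_) R ++ concatMap (λ a → map (a ∷_) (replicate m 0 ∷ R)) (applyUpTo suc k) ,
  cong (λ W → concatMap (λ a → map (a ∷_) W) (upTo (suc k))) lex≡ ,
  ++⁺ (map⁺ R≥1)
      (concat⁺ (map⁺ (applyUpTo⁺₂ suc k (λ _ → map⁺ (All.universal (λ _ → s≤s z≤n) _)))))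

module KeyBlocks (m k : ℕ) (R : List Word) (lex≡ : wordsLex m (suc k) ≡ replicate m 0 ∷ R)
                 (R≥1 : All (λ u → 1 ≤ weight u) R) where

  heavyKeys : ℕ → List Word
  heavyKeys a = filterᵇ isKey (map reverse (map (a ∷_) R))

  block : ℕ → List Word
  block a = padded m a 0 ∷ heavyKeys a

  heavyKeys-heavy : ∀ a → All (λ v → 2 ≤ weight v) (heavyKeys a)
  heavyKeys-heavy a = All.zipWith (λ (key , heavy) → heavy key)
    ( all-filter (T? ∘ isKey) candidates
    , filter⁺ (T? ∘ isKey) {Q = KeyHeavy} (map⁺ (map⁺ (All.map (λ {u} → reversed-key-heavy u) R≥1))))
    where
    candidates = map reverse (map (a ∷_) R)
    KeyHeavy : Word → Set
    KeyHeavy v = T (isKey v) → 2 ≤ weight v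
    reversed-key-heavy : ∀ u → 1 ≤ weight u → KeyHeavy (reverse (a ∷ u))
    reversed-key-heavy u u≥1 rewrite unfold-reverse a u =
      key-weight≥2 (reverse u) a (subst (1 ≤_) (sym (weight-reverse u)) u≥1)

  keys≡blocks : keys (suc m) (suc k) ≡ concatMap block (upTo (suc k))
  keys≡blocks = begin
    filterᵇ isKey (map reverse (concatMap column (upTo (suc k))))
      ≡⟨ cong (filterᵇ isKey) (map-concatMap reverse column (upTo (suc k))) ⟩
    filterᵇ isKey (concatMap (map reverse ∘ column) (upTo (suc k)))
      ≡⟨ filter-concatMap (T? ∘ isKey) (map reverse ∘ column) (upTo (suc k)) ⟩
    concatMap (filterᵇ isKey ∘ map reverse ∘ column) (upTo (suc k))
      ≡⟨ concatMap-cong block≡ (upTo (suc k)) ⟩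
    concatMap block (upTo (suc k)) ∎
    where
    column : ℕ → List Word
    column a = map (a ∷_) (wordsLex m (suc k))
    block≡ : ∀ a → filterᵇ isKey (map reverse (column a)) ≡ block a
    block≡ a = begin
      filterᵇ isKey (map reverse (column a))
        ≡⟨ cong (filterᵇ isKey ∘ map reverse ∘ map (a ∷_)) lex≡ ⟩
      filterᵇ isKey (reverse (padded 0 a m) ∷ map reverse (map (a ∷_) R))
        ≡⟨ cong (λ v → filterᵇ isKey (v ∷ map reverse (map (a ∷_) R))) (reverse-padded 0 a m) ⟩
      filterᵇ isKey (padded m a 0 ∷ map reverse (map (a ∷_) R))
        ≡⟨ filter-accept (T? ∘ isKey) (isKey-padded m a) ⟩
      block a ∎

  open Pivots m

  foldl-block : ∀ {j D} → EndsWithPivot j D → EndsWithPivot (suc j) (foldl step D (block (suc j)))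
  foldl-block {j} ends = foldl-heavy (heavyKeys (suc j)) (heavyKeys-heavy (suc j)) (step-simple ends)

  foldl-blocks : ∀ {D} → EndsWithPivot 0 D →
                 ∀ a → EndsWithPivot a (foldl step D (concatMap block (applyUpTo suc a)))
  foldl-blocks ends zero        = ends
  foldl-blocks {D} ends (suc a) =
    subst (EndsWithPivot (suc a)) (sym fold≡) (foldl-block (foldl-blocks ends a))
    where
    previous = foldl step D (concatMap block (applyUpTo suc a))
    fold≡ : foldl step D (concatMap block (applyUpTo suc (suc a))) ≡ foldl step previous (block (suc a))
    fold≡ = begin
      foldl step D (concatMap block (applyUpTo suc (suc a)))
        ≡⟨ cong (foldl step D ∘ concatMap block) (applyUpTo-∷ʳ suc a) ⟨
      foldl step D (concatMap block (applyUpTo suc a ∷ʳ suc a))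
        ≡⟨ cong (foldl step D) (concatMap-++ block (applyUpTo suc a) [ suc a ]) ⟩
      foldl step D (concatMap block (applyUpTo suc a) ++ block (suc a) ++ [])
        ≡⟨ foldl-++ step D (concatMap block (applyUpTo suc a)) _ ⟩
      foldl step previous (block (suc a) ++ [])
        ≡⟨ cong (foldl step previous) (++-identityʳ (block (suc a))) ⟩
      foldl step previous (block (suc a)) ∎

  D-ends-with-pivot : EndsWithPivot k (D (suc m) (suc k))
  D-ends-with-pivot = subst (EndsWithPivot k) (sym D≡)
    (foldl-blocks (foldl-heavy (heavyKeys 0) (heavyKeys-heavy 0) (ending [] refl [])) k)
    where
    D≡ : D (suc m) (suc k)
       ≡ foldl step (foldl step [ pivot 0 ] (heavyKeys 0)) (concatMap block (applyUpTo suc k))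
    D≡ = trans (cong (foldl step [ pivot 0 ] ∘ drop 1) keys≡blocks)
               (foldl-++ step [ pivot 0 ] (heavyKeys 0) _)

corollary1 : (n k : ℕ) → 1 ≤ n → 1 ≤ k →
    last (D n k) ≡ just ((k ∸ 1) ∷ replicate (n ∸ 1) 0)
corollary1 (suc m) (suc k) _ _ with wordsLex-zeros-first m k
... | R , lex≡ , R≥1 with KeyBlocks.D-ends-with-pivot m k R lex≡ R≥1
...   | Pivots.ending P D≡ _ = trans (cong last D≡) (last-∷ʳ P _)
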